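{- Let $D$ be a digraph of order $n\geq 3$, let $C:=x_1x_2\ldots x_{n-1}x_1$ be any cycle of length $n-1$ in $D$ (indices taken modulo $n-1$), and let $y$ be the vertex not on $C$. If $D$ contains no Hamiltonian bypass, then (i) $d^+(y,\{x_i,x_{i+1}\})\leq 1$ and $d^-(y,\{x_i,x_{i+1}\})\leq 1$ for all $i\in[1,n-1]$; (ii) $d^+(y)\leq (n-1)/2$, $d^-(y)\leq (n-1)/2$ and $d(y)\leq n-1$; (iii) if $x_ky, yx_{k+1}$ are arcs of $D$, then $x_{i+1}x_i$ is not an arc of $D$ for every $x_i\neq x_k$.
   Context: Digraphs are finite, without loops or multiple arcs. For a vertex $x$ and a set $A$ of vertices, $d^+(x,A)$ (resp. $d^-(x,A)$) is the number of vertices $a\in A$ with $xa$ (resp. $ax$) an arc; $d(x)=d^+(x)+d^-(x)$. A Hamiltonian bypass in $D$ is a subdigraph obtained from a Hamiltonian cycle by reversing exactly one arc. -}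

module Defs where

open import Data.Nat using (ℕ; zero; suc; _+_)
open import Data.Bool using (Bool; true; false; if_then_else_; _∧_; _∨_)
open import Data.Fin using (Fin; zero; suc; toℕ; fromℕ; inject₁; _≟_)
open import Data.Product using (Σ; _×_)
open import Relation.Binary.PropositionalEquality using (_≡_; _≢_)
open import Relation.Nullary.Decidable using (⌊_⌋)
open import Function.Definitions using (Injective)

-- Multiple arcs are excluded automatically; loops are excluded by `loopless`.
record Digraph (n : ℕ) : Set where
  field
    arc      : Fin n → Fin n → Bool
    loopless : ∀ x → arc x x ≡ false
open Digraph public

_⟶[_]_ : ∀ {n} → Fin n → Digraph n → Fin n → Set
x ⟶[ D ] y = arc D x y ≡ true

-- Cyclic successor on Fin (suc m): i ↦ i + 1 mod (suc m).
next : ∀ {m} → Fin (suc m) → Fin (suc m)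
next {zero}  zero    = zero
next {suc m} zero    = suc zero
next {suc m} (suc i) with next {m} i
... | zero  = zero
... | suc j = suc (suc j)

count : ∀ {n} → (Fin n → Bool) → ℕ
count {zero}  P = 0
count {suc n} P = (if P zero then 1 else 0) + count (λ i → P (suc i))

VSet : ℕ → Set
VSet n = Fin n → Bool

d⁺[_]_,_ : ∀ {n} → Digraph n → Fin n → VSet n → ℕ
d⁺[ D ] x , A = count (λ a → A a ∧ arc D x a)

d⁻[_]_,_ : ∀ {n} → Digraph n → Fin n → VSet n → ℕ
d⁻[ D ] x , A = count (λ a → A a ∧ arc D a x)

d⁺[_] : ∀ {n} → Digraph n → Fin n → ℕ
d⁺[ D ] x = count (λ a → arc D x a)

d⁻[_] : ∀ {n} → Digraph n → Fin n → ℕ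
d⁻[ D ] x = count (λ a → arc D a x)

deg[_] : ∀ {n} → Digraph n → Fin n → ℕ
deg[ D ] x = d⁺[ D ] x + d⁻[ D ] x

pair : ∀ {n} → Fin n → Fin n → VSet n
pair a b v = ⌊ v ≟ a ⌋ ∨ ⌊ v ≟ b ⌋

IsCycle : ∀ {n m} → Digraph n → (Fin (suc m) → Fin n) → Set
IsCycle D x = Injective _≡_ _≡_ x × (∀ i → x i ⟶[ D ] x (next i))

-- A Hamiltonian bypass of D (order suc m): a cyclic ordering v₀ … v_m of all vertices
-- (a bijection, here: injective map Fin (suc m) → Fin (suc m)) together with an index j
-- such that v_i v_{i+1} is an arc for all i ≠ j, and the arc v_j v_{j+1} of the
-- Hamiltonian cycle is reversed, i.e. v_{j+1} v_j is an arc of D.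
HamiltonianBypass : ∀ {m} → Digraph (suc m) → Set
HamiltonianBypass {m} D =
  Σ (Fin (suc m) → Fin (suc m)) λ v →
    Injective _≡_ _≡_ v ×
    Σ (Fin (suc m)) λ j →
      (∀ i → i ≢ j → v i ⟶[ D ] v (next i)) × (v (next j) ⟶[ D ] v j)

module Submission where

open import Defs
open import Data.Nat using (ℕ; suc; _≤_; _*_; _+_)
open import Data.Fin using (Fin)
open import Data.Bool using (false)
open import Data.Product using (_×_)
open import Relation.Binary.PropositionalEquality using (_≡_; _≢_)
open import Relation.Nullary using (¬_)

open import Data.Nat using (zero; s≤s; z≤n)
open import Data.Nat.Properties
  using (+-comm; +-assoc; +-suc; +-identityʳ; *-suc; *-distribˡ-+; +-monoʳ-≤; +-mono-≤;
         +-cancelʳ-≤; *-cancelˡ-≤; ≤-antisym; ≤-reflexive; m≤n⇒m≤1+n; +-commutativeSemigroup;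
         module ≤-Reasoning)
open import Data.Nat.DivMod using (_%_; m%n<n; n%n≡0; m%n%n≡m%n; %-distribˡ-+; [m+n]%n≡m%n;
                                   [m+kn]%n≡m%n; m<n⇒m%n≡m)
open import Data.Fin using (zero; suc; toℕ; fromℕ; fromℕ<; inject₁; _≟_)
open import Data.Fin.Properties using (toℕ-injective; toℕ-fromℕ<; toℕ-fromℕ; toℕ-inject₁; toℕ<n; suc-injective; 0≢1+n)
open import Data.Fin.Relation.Unary.Top using (view; ‵fromℕ; ‵inject₁)
open import Data.Vec.Functional using (_∷_)
open import Data.Bool using (Bool; true; not; if_then_else_; _∧_)
open import Data.Bool.Properties using (∧-identityʳ; ∧-conicalˡ; ∧-conicalʳ; ¬-not)
-- Pairs are written with _&_ because Defs uses ',' in the degree notation d⁺[ D ] x , A.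
open import Data.Product using (proj₁; proj₂) renaming (_,_ to _&_)
open import Data.Sum using (_⊎_; inj₁; inj₂)
open import Data.Empty using (⊥; ⊥-elim)
open import Function using (_∘_)
open import Function.Definitions using (Injective)
open import Relation.Binary.PropositionalEquality using (refl; sym; trans; cong; cong₂; subst; subst₂; module ≡-Reasoning)
open import Relation.Nullary using (yes; no)
open import Relation.Nullary.Decidable using (⌊_⌋)
open import Algebra.Properties.CommutativeSemigroup +-commutativeSemigroup using (x∙yz≈y∙xz)

-- Write the cycle as x₀ … x_m and insert y between x_b and x_{b+1}:
-- the cyclic order  y, x_{b+1}, x_{b+2}, …, x_b  has all its arcs present in D
-- except possibly x_b y and y x_{b+1}.  Hence
--   * y → x_b and y → x_{b+1} give a bypass reversing x_b y;
--   * x_b → y and x_{b+1} → y give a bypass reversing y x_{b+1};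
--   * x_b → y → x_{b+1} and a reversed cycle arc x_{i+1} → x_i (i ≠ b) give a
--     bypass reversing x_i x_{i+1}.
-- So without bypasses y has no out-neighbours (or in-neighbours) on two
-- consecutive cycle vertices, which is (i) and (iii).  For (ii), a set of cycle
-- vertices containing no two consecutive ones has at most half of the m + 1
-- vertices, since it and its image under the cyclic successor are disjoint.

Exclusive : Bool → Bool → Set
Exclusive a b = a ≡ true → b ≡ true → ⊥

next-fromℕ : ∀ m → next (fromℕ m) ≡ zero
next-fromℕ zero = refl
next-fromℕ (suc m) with next (fromℕ m) | next-fromℕ m
... | .zero | refl = refl

next-inject₁ : ∀ {m} (j : Fin m) → next (inject₁ j) ≡ suc j
next-inject₁ zero = refl
next-inject₁ (suc j) with next (inject₁ j) | next-inject₁ j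
... | .(suc j) | refl = refl

toℕ-next : ∀ {m} (i : Fin (suc m)) → toℕ (next i) ≡ suc (toℕ i) % suc m
toℕ-next {m} i with view i
... | ‵fromℕ rewrite next-fromℕ m | toℕ-fromℕ m = sym (n%n≡0 (suc m))
... | ‵inject₁ j rewrite next-inject₁ j | toℕ-inject₁ j = sym (m<n⇒m%n≡m (s≤s (toℕ<n j)))

-- Rotations of Fin (suc m)

[m+n%d]%d≡[m+n]%d : ∀ a b d → (a + b % suc d) % suc d ≡ (a + b) % suc d
[m+n%d]%d≡[m+n]%d a b d = begin
  (a + b % suc d) % suc d                        ≡⟨ %-distribˡ-+ a (b % suc d) (suc d) ⟩
  (a % suc d + b % suc d % suc d) % suc d        ≡⟨ cong (λ t → (a % suc d + t) % suc d) (m%n%n≡m%n b (suc d)) ⟩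
  (a % suc d + b % suc d) % suc d                ≡⟨ sym (%-distribˡ-+ a b (suc d)) ⟩
  (a + b) % suc d                                ∎
  where open ≡-Reasoning

rotate : ∀ {m} → ℕ → Fin (suc m) → Fin (suc m)
rotate {m} c i = fromℕ< (m%n<n (c + toℕ i) (suc m))

toℕ-rotate : ∀ {m} c (i : Fin (suc m)) → toℕ (rotate c i) ≡ (c + toℕ i) % suc m
toℕ-rotate c i = toℕ-fromℕ< _

rotate-rotate : ∀ {m} a b (i : Fin (suc m)) → rotate a (rotate b i) ≡ rotate (a + b) i
rotate-rotate {m} a b i = toℕ-injective (begin
  toℕ (rotate a (rotate b i))        ≡⟨ toℕ-rotate a (rotate b i) ⟩
  (a + toℕ (rotate b i)) % suc m     ≡⟨ cong (λ t → (a + t) % suc m) (toℕ-rotate b i) ⟩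
  (a + (b + toℕ i) % suc m) % suc m  ≡⟨ [m+n%d]%d≡[m+n]%d a (b + toℕ i) m ⟩
  (a + (b + toℕ i)) % suc m          ≡⟨ cong (_% suc m) (sym (+-assoc a b (toℕ i))) ⟩
  (a + b + toℕ i) % suc m            ≡⟨ sym (toℕ-rotate (a + b) i) ⟩
  toℕ (rotate (a + b) i)             ∎)
  where open ≡-Reasoning

rotate-period : ∀ {m} k (i : Fin (suc m)) → rotate (k * suc m) i ≡ i
rotate-period {m} k i = toℕ-injective (begin
  toℕ (rotate (k * suc m) i)      ≡⟨ toℕ-rotate (k * suc m) i ⟩
  (k * suc m + toℕ i) % suc m     ≡⟨ cong (_% suc m) (+-comm (k * suc m) (toℕ i)) ⟩
  (toℕ i + k * suc m) % suc m     ≡⟨ [m+kn]%n≡m%n (toℕ i) k (suc m) ⟩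
  toℕ i % suc m                   ≡⟨ m<n⇒m%n≡m (toℕ<n i) ⟩
  toℕ i                           ∎)
  where open ≡-Reasoning

rotate-inverseˡ : ∀ {m} c (i : Fin (suc m)) → rotate (c * m) (rotate c i) ≡ i
rotate-inverseˡ {m} c i = begin
  rotate (c * m) (rotate c i)  ≡⟨ rotate-rotate (c * m) c i ⟩
  rotate (c * m + c) i         ≡⟨ cong (λ t → rotate t i) (trans (+-comm (c * m) c) (sym (*-suc c m))) ⟩
  rotate (c * suc m) i         ≡⟨ rotate-period c i ⟩
  i                            ∎
  where open ≡-Reasoning

rotate-inverseʳ : ∀ {m} c (i : Fin (suc m)) → rotate c (rotate (c * m) i) ≡ i
rotate-inverseʳ {m} c i = begin
  rotate c (rotate (c * m) i)  ≡⟨ rotate-rotate c (c * m) i ⟩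
  rotate (c + c * m) i         ≡⟨ cong (λ t → rotate t i) (sym (*-suc c m)) ⟩
  rotate (c * suc m) i         ≡⟨ rotate-period c i ⟩
  i                            ∎
  where open ≡-Reasoning

rotate-injective : ∀ {m} c → Injective _≡_ _≡_ (rotate {m} c)
rotate-injective c {i} {j} e =
  trans (sym (rotate-inverseˡ c i)) (trans (cong (rotate (c * _)) e) (rotate-inverseˡ c j))

next≡rotate-1 : ∀ {m} (i : Fin (suc m)) → next i ≡ rotate 1 i
next≡rotate-1 i = toℕ-injective (trans (toℕ-next i) (sym (toℕ-rotate 1 i)))

next-injective : ∀ {m} → Injective _≡_ _≡_ (next {m})
next-injective {_} {i} {j} e =
  rotate-injective 1 (trans (sym (next≡rotate-1 i)) (trans e (next≡rotate-1 j)))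

rotate-next : ∀ {m} c (i : Fin (suc m)) → rotate c (next i) ≡ next (rotate c i)
rotate-next c i = begin
  rotate c (next i)      ≡⟨ cong (rotate c) (next≡rotate-1 i) ⟩
  rotate c (rotate 1 i)  ≡⟨ rotate-rotate c 1 i ⟩
  rotate (c + 1) i       ≡⟨ cong (λ t → rotate t i) (+-comm c 1) ⟩
  rotate (1 + c) i       ≡⟨ sym (rotate-rotate 1 c i) ⟩
  rotate 1 (rotate c i)  ≡⟨ sym (next≡rotate-1 (rotate c i)) ⟩
  next (rotate c i)      ∎
  where open ≡-Reasoning

rotate-fromℕ : ∀ {m} (b : Fin (suc m)) → rotate (suc (toℕ b)) (fromℕ m) ≡ b
rotate-fromℕ {m} b = toℕ-injective (begin
  toℕ (rotate (suc (toℕ b)) (fromℕ m))      ≡⟨ toℕ-rotate (suc (toℕ b)) (fromℕ m) ⟩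
  (suc (toℕ b) + toℕ (fromℕ m)) % suc m     ≡⟨ cong (λ t → (suc (toℕ b) + t) % suc m) (toℕ-fromℕ m) ⟩
  (suc (toℕ b) + m) % suc m                 ≡⟨ cong (_% suc m) (sym (+-suc (toℕ b) m)) ⟩
  (toℕ b + suc m) % suc m                   ≡⟨ [m+n]%n≡m%n (toℕ b) (suc m) ⟩
  toℕ b % suc m                             ≡⟨ m<n⇒m%n≡m (toℕ<n b) ⟩
  toℕ b                                     ∎)
  where open ≡-Reasoning

rotate-zero : ∀ {m} (b : Fin (suc m)) → rotate (suc (toℕ b)) zero ≡ next b
rotate-zero {m} b = begin
  rotate (suc (toℕ b)) zero                  ≡⟨ cong (rotate (suc (toℕ b))) (sym (next-fromℕ m)) ⟩
  rotate (suc (toℕ b)) (next (fromℕ m))      ≡⟨ rotate-next (suc (toℕ b)) (fromℕ m) ⟩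
  next (rotate (suc (toℕ b)) (fromℕ m))      ≡⟨ cong next (rotate-fromℕ b) ⟩
  next b                                     ∎
  where open ≡-Reasoning

rotate-cycle : ∀ {n m} {D : Digraph n} {x : Fin (suc m) → Fin n} (c : ℕ)
             → IsCycle D x → IsCycle D (x ∘ rotate c)
rotate-cycle {D = D} {x} c (x-inj & x-arc) =
  (λ e → rotate-injective c (x-inj e)) &
  (λ i → subst (λ j → x (rotate c i) ⟶[ D ] x j) (sym (rotate-next c i)) (x-arc (rotate c i)))

-- Counting

[_] : Bool → ℕ
[ b ] = if b then 1 else 0

count-cong : ∀ {n} {P Q : Fin n → Bool} → (∀ i → P i ≡ Q i) → count P ≡ count Q
count-cong {zero} h = refl
count-cong {suc n} h = cong₂ _+_ (cong [_] (h zero)) (count-cong (h ∘ suc))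

count-none : ∀ {n} (P : Fin n → Bool) → (∀ i → P i ≡ false) → count P ≡ 0
count-none {zero} P h = refl
count-none {suc n} P h rewrite h zero = count-none (P ∘ suc) (h ∘ suc)

count-≤1 : ∀ {n} (P : Fin n → Bool) → (∀ a b → P a ≡ true → P b ≡ true → a ≡ b) → count P ≤ 1
count-≤1 {zero} P unique = z≤n
count-≤1 {suc n} P unique with P zero in P0
... | true = ≤-reflexive (cong suc (count-none (P ∘ suc) elsewhere))
  where
  elsewhere : ∀ i → P (suc i) ≡ false
  elsewhere i = ¬-not (λ Pi → 0≢1+n (unique zero (suc i) P0 Pi))
... | false = count-≤1 (P ∘ suc) (λ a b Pa Pb → suc-injective (unique (suc a) (suc b) Pa Pb))

count-compl : ∀ {n} (P : Fin n → Bool) → count P + count (not ∘ P) ≡ n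
count-compl {zero} P = refl
count-compl {suc n} P with P zero
... | true = cong suc (count-compl (P ∘ suc))
... | false = trans (+-suc _ _) (cong suc (count-compl (P ∘ suc)))

count-disjoint : ∀ {n} (A B : Fin n → Bool) → (∀ i → Exclusive (A i) (B i)) → count A + count B ≤ n
count-disjoint {zero} A B h = z≤n
count-disjoint {suc n} A B h with A zero | B zero | h zero
... | true | true | h0 = ⊥-elim (h0 refl refl)
... | true | false | _ = s≤s (count-disjoint (A ∘ suc) (B ∘ suc) (h ∘ suc))
... | false | true | _ =
  subst (_≤ suc n) (sym (+-suc _ _)) (s≤s (count-disjoint (A ∘ suc) (B ∘ suc) (h ∘ suc)))
... | false | false | _ = m≤n⇒m≤1+n (count-disjoint (A ∘ suc) (B ∘ suc) (h ∘ suc))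

count-split : ∀ {n} (P : Fin n → Bool) (z : Fin n) →
  count P ≡ [ P z ] + count (λ w → P w ∧ not ⌊ w ≟ z ⌋)
count-split {suc n} P zero with P zero
... | true = cong suc (count-cong (λ i → sym (∧-identityʳ (P (suc i)))))
... | false = count-cong (λ i → sym (∧-identityʳ (P (suc i))))
count-split {suc n} P (suc z) = begin
  [ P zero ] + count (P ∘ suc)
    ≡⟨ cong ([ P zero ] +_) (count-split (P ∘ suc) z) ⟩
  [ P zero ] + ([ P (suc z) ] + count (λ i → P (suc i) ∧ not ⌊ i ≟ z ⌋))
    ≡⟨ x∙yz≈y∙xz [ P zero ] [ P (suc z) ] _ ⟩
  [ P (suc z) ] + ([ P zero ] + count (λ i → P (suc i) ∧ not ⌊ i ≟ z ⌋))
    ≡⟨ cong ([ P (suc z) ] +_) (cong₂ _+_ (cong [_] (sym (∧-identityʳ (P zero))))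
          (count-cong (λ i → cong (λ t → P (suc i) ∧ not t) (sym (≟-suc i z))))) ⟩
  [ P (suc z) ] + ([ P zero ∧ true ] + count (λ i → P (suc i) ∧ not ⌊ suc i ≟ suc z ⌋)) ∎
  where
  open ≡-Reasoning
  ≟-suc : (i j : Fin n) → ⌊ suc i ≟ suc j ⌋ ≡ ⌊ i ≟ j ⌋
  ≟-suc i j with i ≟ j
  ... | yes _ = refl
  ... | no _ = refl

count-injective : ∀ {k n} (x : Fin k → Fin n) → Injective _≡_ _≡_ x → (Q : Fin n → Bool) →
  count (Q ∘ x) ≤ count Q
count-injective {zero} x inj Q = z≤n
count-injective {suc k} x inj Q = begin
  [ Q (x zero) ] + count (Q ∘ x ∘ suc)
    ≡⟨ cong ([ Q (x zero) ] +_) (count-cong (λ i → sym (Q⁻-on-rest i))) ⟩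
  [ Q (x zero) ] + count (Q⁻ ∘ x ∘ suc)
    ≤⟨ +-monoʳ-≤ [ Q (x zero) ] (count-injective (x ∘ suc) (λ e → suc-injective (inj e)) Q⁻) ⟩
  [ Q (x zero) ] + count Q⁻
    ≡⟨ sym (count-split Q (x zero)) ⟩
  count Q ∎
  where
  open ≤-Reasoning
  Q⁻ : Fin _ → Bool
  Q⁻ w = Q w ∧ not ⌊ w ≟ x zero ⌋
  Q⁻-on-rest : ∀ i → Q⁻ (x (suc i)) ≡ Q (x (suc i))
  Q⁻-on-rest i with x (suc i) ≟ x zero
  ... | yes e = ⊥-elim (0≢1+n (inj (sym e)))
  ... | no _ = ∧-identityʳ _

count-image-bound : ∀ {k n} (x : Fin k → Fin n) → Injective _≡_ _≡_ x → (P : Fin n → Bool)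
  → count P + k ≤ count (P ∘ x) + n
count-image-bound {k} {n} x inj P = begin
  count P + k
    ≡⟨ cong (count P +_) (sym (count-compl (P ∘ x))) ⟩
  count P + (count (P ∘ x) + count (not ∘ P ∘ x))
    ≤⟨ +-monoʳ-≤ (count P) (+-monoʳ-≤ (count (P ∘ x)) (count-injective x inj (not ∘ P))) ⟩
  count P + (count (P ∘ x) + count (not ∘ P))
    ≡⟨ x∙yz≈y∙xz (count P) (count (P ∘ x)) (count (not ∘ P)) ⟩
  count (P ∘ x) + (count P + count (not ∘ P))
    ≡⟨ cong (count (P ∘ x) +_) (count-compl P) ⟩
  count (P ∘ x) + n ∎
  where open ≤-Reasoning

count-∘next : ∀ {m} (Q : Fin (suc m) → Bool) → count (Q ∘ next) ≡ count Q
count-∘next Q = ≤-antisym (count-injective next next-injective Q)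
                          (+-cancelʳ-≤ _ _ _ (count-image-bound next next-injective Q))

∷-injective : ∀ {k n} {x : Fin k → Fin n} {y : Fin n} → Injective _≡_ _≡_ x → (∀ i → x i ≢ y)
  → Injective _≡_ _≡_ (y ∷ x)
∷-injective inj y∉x {zero} {zero} _ = refl
∷-injective inj y∉x {zero} {suc j} e = ⊥-elim (y∉x j (sym e))
∷-injective inj y∉x {suc i} {zero} e = ⊥-elim (y∉x i e)
∷-injective inj y∉x {suc i} {suc j} e = cong suc (inj e)

count-outside : ∀ {k} {x : Fin k → Fin (suc k)} {y : Fin (suc k)} → Injective _≡_ _≡_ x
  → (∀ i → x i ≢ y) → (P : Fin (suc k) → Bool) → P y ≡ false → count P ≤ count (P ∘ x)
count-outside {k} {x} {y} inj y∉x P Py =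
  +-cancelʳ-≤ (suc k) _ _ (subst (λ c → count P + suc k ≤ c + suc k) P∘y∷x≡P∘x
                                 (count-image-bound (y ∷ x) (∷-injective inj y∉x) P))
  where
  P∘y∷x≡P∘x : count (P ∘ (y ∷ x)) ≡ count (P ∘ x)
  P∘y∷x≡P∘x rewrite Py = refl

half-bound : ∀ {m} {x : Fin (suc m) → Fin (2 + m)} {y : Fin (2 + m)} → Injective _≡_ _≡_ x
  → (∀ i → x i ≢ y) → (P : Fin (2 + m) → Bool) → P y ≡ false
  → (∀ i → Exclusive (P (x i)) (P (x (next i)))) → 2 * count P ≤ suc m
half-bound {m} {x} inj y∉x P Py sep = begin
  count P + (count P + 0)              ≡⟨ cong (count P +_) (+-identityʳ (count P)) ⟩
  count P + count P                    ≤⟨ +-mono-≤ on-cycle on-cycle ⟩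
  count (P ∘ x) + count (P ∘ x)        ≡⟨ cong (count (P ∘ x) +_) (sym (count-∘next (P ∘ x))) ⟩
  count (P ∘ x) + count (P ∘ x ∘ next) ≤⟨ count-disjoint (P ∘ x) (P ∘ x ∘ next) sep ⟩
  suc m                                ∎
  where
  open ≤-Reasoning
  on-cycle : count P ≤ count (P ∘ x)
  on-cycle = count-outside inj y∉x P Py

halves-sum : ∀ {a b n} → 2 * a ≤ n → 2 * b ≤ n → a + b ≤ n
halves-sum {a} {b} {n} 2a≤n 2b≤n = *-cancelˡ-≤ 2 (begin
  2 * (a + b)      ≡⟨ *-distribˡ-+ 2 a b ⟩
  2 * a + 2 * b    ≤⟨ +-mono-≤ 2a≤n 2b≤n ⟩
  n + n            ≡⟨ cong (n +_) (sym (+-identityʳ n)) ⟩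
  2 * n            ∎)
  where open ≤-Reasoning

pair-member : ∀ {n} (u w a : Fin n) → pair u w a ≡ true → a ≡ u ⊎ a ≡ w
pair-member u w a h with a ≟ u | a ≟ w
... | yes a≡u | _ = inj₁ a≡u
... | no _ | yes a≡w = inj₂ a≡w

count-pair-≤1 : ∀ {n} (u w : Fin n) (Q : Fin n → Bool) → Exclusive (Q u) (Q w)
  → count (λ a → pair u w a ∧ Q a) ≤ 1
count-pair-≤1 u w Q excl = count-≤1 _ same
  where
  same : ∀ a b → pair u w a ∧ Q a ≡ true → pair u w b ∧ Q b ≡ true → a ≡ b
  same a b ha hb with pair-member u w a (∧-conicalˡ _ _ ha) | pair-member u w b (∧-conicalˡ _ _ hb)
  ... | inj₁ a≡u | inj₁ b≡u = trans a≡u (sym b≡u)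
  ... | inj₂ a≡w | inj₂ b≡w = trans a≡w (sym b≡w)
  ... | inj₁ refl | inj₂ refl = ⊥-elim (excl (∧-conicalʳ _ _ ha) (∧-conicalʳ _ _ hb))
  ... | inj₂ refl | inj₁ refl = ⊥-elim (excl (∧-conicalʳ _ _ hb) (∧-conicalʳ _ _ ha))

-- Hamiltonian bypasses obtained by inserting y into the cycle

-- Insertion of y between the last cycle vertex x_m and x₀: the cyclic order
-- v = y, x₀, …, x_m has every arc except possibly x_m y and y x₀.
module Insertion {m} (D : Digraph (2 + m)) {x : Fin (suc m) → Fin (2 + m)} (cyc : IsCycle D x)
                 {y : Fin (2 + m)} (y∉x : ∀ i → x i ≢ y) where

  v : Fin (2 + m) → Fin (2 + m)
  v = y ∷ x

  last : Fin (2 + m)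
  last = fromℕ (suc m)

  v-next-inner : (j : Fin m) → v (next (suc (inject₁ j))) ≡ x (next (inject₁ j))
  v-next-inner j = trans (cong v (next-inject₁ (suc j))) (cong x (sym (next-inject₁ j)))

  arcs : (r : Fin (2 + m)) → (zero ≢ r → y ⟶[ D ] x zero) → (last ≢ r → x (fromℕ m) ⟶[ D ] y)
       → ∀ p → p ≢ r → v p ⟶[ D ] v (next p)
  arcs r first final zero p≢r = first p≢r
  arcs r first final (suc j) p≢r with view j
  ... | ‵fromℕ = subst (λ q → x (fromℕ m) ⟶[ D ] v q) (sym (next-fromℕ (suc m))) (final p≢r)
  ... | ‵inject₁ i = subst (x (inject₁ i) ⟶[ D ]_) (sym (v-next-inner i)) (proj₂ cyc (inject₁ i))

  bypass : (r : Fin (2 + m)) → v (next r) ⟶[ D ] v r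
         → (zero ≢ r → y ⟶[ D ] x zero) → (last ≢ r → x (fromℕ m) ⟶[ D ] y)
         → HamiltonianBypass D
  bypass r reversed first final =
    v & ∷-injective (proj₁ cyc) y∉x & r & arcs r first final & reversed

  two-out : y ⟶[ D ] x (fromℕ m) → y ⟶[ D ] x zero → HamiltonianBypass D
  two-out y→xm y→x0 = bypass last reversed (λ _ → y→x0) (λ last≢last → ⊥-elim (last≢last refl))
    where
    reversed : v (next last) ⟶[ D ] v last
    reversed = subst (λ q → v q ⟶[ D ] x (fromℕ m)) (sym (next-fromℕ (suc m))) y→xm

  two-in : x (fromℕ m) ⟶[ D ] y → x zero ⟶[ D ] y → HamiltonianBypass D
  two-in xm→y x0→y = bypass zero x0→y (λ zero≢zero → ⊥-elim (zero≢zero refl)) (λ _ → xm→y)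

  reversed-arc : x (fromℕ m) ⟶[ D ] y → y ⟶[ D ] x zero
               → (j : Fin m) → x (next (inject₁ j)) ⟶[ D ] x (inject₁ j) → HamiltonianBypass D
  reversed-arc xm→y y→x0 j back =
    bypass (suc (inject₁ j)) (subst (_⟶[ D ] x (inject₁ j)) (sym (v-next-inner j)) back)
           (λ _ → y→x0) (λ _ → xm→y)

-- The same three constructions for insertion between arbitrary consecutive x_b and x_{b+1}:
-- rotate the cycle so that x_b comes last.
module Bypasses {m} (D : Digraph (2 + m)) {x : Fin (suc m) → Fin (2 + m)} (cyc : IsCycle D x)
                {y : Fin (2 + m)} (y∉x : ∀ i → x i ≢ y) (b : Fin (suc m)) where

  private
    c : ℕ
    c = suc (toℕ b)
    open Insertion D (rotate-cycle {D = D} c cyc) (λ i → y∉x (rotate c i))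

    last↦b : x (rotate c (fromℕ m)) ≡ x b
    last↦b = cong x (rotate-fromℕ b)

    zero↦next-b : x (rotate c zero) ≡ x (next b)
    zero↦next-b = cong x (rotate-zero b)

  two-out-arcs : y ⟶[ D ] x b → y ⟶[ D ] x (next b) → HamiltonianBypass D
  two-out-arcs y→xb y→xb' =
    two-out (subst (y ⟶[ D ]_) (sym last↦b) y→xb) (subst (y ⟶[ D ]_) (sym zero↦next-b) y→xb')

  two-in-arcs : x b ⟶[ D ] y → x (next b) ⟶[ D ] y → HamiltonianBypass D
  two-in-arcs xb→y xb'→y =
    two-in (subst (_⟶[ D ] y) (sym last↦b) xb→y) (subst (_⟶[ D ] y) (sym zero↦next-b) xb'→y)

  reversed-cycle-arc : x b ⟶[ D ] y → y ⟶[ D ] x (next b)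
                     → (i : Fin (suc m)) → i ≢ b → x (next i) ⟶[ D ] x i → HamiltonianBypass D
  reversed-cycle-arc xb→y y→xb' i i≢b back = at-position (rotate (c * m) i) (rotate-inverseʳ c i)
    where
    -- position t of the rotated cycle is i, and t is not its last position since i ≢ b
    at-position : (t : Fin (suc m)) → rotate c t ≡ i → HamiltonianBypass D
    at-position t t↦i with view t
    ... | ‵fromℕ = ⊥-elim (i≢b (trans (sym t↦i) (rotate-fromℕ b)))
    ... | ‵inject₁ j = reversed-arc (subst (_⟶[ D ] y) (sym last↦b) xb→y)
                                           (subst (y ⟶[ D ]_) (sym zero↦next-b) y→xb') j
            (subst₂ (λ p q → x p ⟶[ D ] x q)
                    (trans (cong next (sym t↦i)) (sym (rotate-next c (inject₁ j)))) (sym t↦i) back)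

lemma4 : (m : ℕ) → 1 ≤ m → (D : Digraph (2 + m))
    → (x : Fin (suc m) → Fin (2 + m)) → IsCycle D x
    → (y : Fin (2 + m)) → (∀ i → x i ≢ y)
    → ¬ HamiltonianBypass D
    → ((∀ i → (d⁺[ D ] y , pair (x i) (x (next i))) ≤ 1
              × (d⁻[ D ] y , pair (x i) (x (next i))) ≤ 1)
       × ((2 * d⁺[ D ] y ≤ suc m) × (2 * d⁻[ D ] y ≤ suc m) × (deg[ D ] y ≤ suc m))
       × (∀ k → x k ⟶[ D ] y → y ⟶[ D ] x (next k)
              → ∀ i → x i ≢ x k → arc D (x (next i)) (x i) ≡ false))
lemma4 m _ D x cyc y y∉x no-bypass =
  (λ i → count-pair-≤1 _ _ (arc D y) (no-two-out i) & count-pair-≤1 _ _ (λ a → arc D a y) (no-two-in i)) &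
  (out-half & in-half & halves-sum {d⁺[ D ] y} {d⁻[ D ] y} out-half in-half) &
  no-reversal
  where
  open Bypasses D cyc y∉x

  no-two-out : ∀ i → Exclusive (arc D y (x i)) (arc D y (x (next i)))
  no-two-out i p q = no-bypass (two-out-arcs i p q)

  no-two-in : ∀ i → Exclusive (arc D (x i) y) (arc D (x (next i)) y)
  no-two-in i p q = no-bypass (two-in-arcs i p q)

  out-half : 2 * d⁺[ D ] y ≤ suc m
  out-half = half-bound (proj₁ cyc) y∉x (arc D y) (loopless D y) no-two-out

  in-half : 2 * d⁻[ D ] y ≤ suc m
  in-half = half-bound (proj₁ cyc) y∉x (λ a → arc D a y) (loopless D y) no-two-in

  no-reversal : ∀ k → x k ⟶[ D ] y → y ⟶[ D ] x (next k)
              → ∀ i → x i ≢ x k → arc D (x (next i)) (x i) ≡ false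
  no-reversal k xk→y y→xk' i xi≢xk =
    ¬-not (λ back → no-bypass (reversed-cycle-arc k xk→y y→xk' i (xi≢xk ∘ cong x) back))
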